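{- Let $n\ge 0$ and $0\le i\le\lfloor n/2\rfloor$ be integers. Then for every integer $r\ge 0$, \[\sum_{\substack{0\le j,k\le i\\ j+k=r}}\binom{n-2j}{i-j}\binom{n-2k}{i-k}\;\ge\;\sum_{\substack{0\le j,k\le i+1\\ j+k=r}}\binom{n-2j}{i-1-j}\binom{n-2k}{i+1-k}.\]
   Context: For integers $a,b$, the binomial coefficient $\binom{a}{b}$ is the usual one when $0\le b\le a$ and is taken to be $0$ otherwise (in particular whenever $b<0$, $b>a$, or $a<0$); equivalently $\binom{a}{b}$ counts north-east lattice paths from $(0,0)$ to $(a-b,b)$. -}

module Defs where

open import Data.Nat using (ℕ; zero; suc; _+_; _*_; _≤?_)
open import Data.Nat.Combinatorics using (_C_)
open import Data.Integer using (ℤ; +_; -[1+_])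
open import Data.List using (List; upTo; map; filter; concatMap)
open import Data.Nat.ListAction using (sum)
open import Data.Product using (_×_; _,_; proj₁; proj₂)
open import Relation.Nullary.Decidable using (yes; no)

-- Binomial coefficient with integer arguments, following the paper's convention:
-- (a choose b) is the usual value when 0 ≤ b ≤ a, and 0 otherwise
-- (nCk already gives 0 when b > a, for natural a b).
binom : ℤ → ℤ → ℕ
binom (+ a) (+ b) = a C b
binom (+ a) -[1+ b ] = 0
binom -[1+ a ] _ = 0

pairs : ℕ → ℕ → List (ℕ × ℕ)
pairs m r = filter (λ p → (proj₁ p + proj₂ p) Data.Nat.≟ r)
              (concatMap (λ j → map (λ k → (j , k)) (upTo (suc m))) (upTo (suc m)))

sumPairs : ℕ → ℕ → (ℕ → ℕ → ℕ) → ℕ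
sumPairs m r f = sum (map (λ p → f (proj₁ p) (proj₂ p)) (pairs m r))

module Submission where

-- Put n = 2i + d and s = i - j. The three binomials become β_d(s) = C(2s+d, s) and its
-- neighbours C(2s+d, s∓1), whose ratios to β_d(s) are s/(s+d+1) and (s+d)/(s+1), and both
-- sides become anti-diagonal sums over s + t = 2i - r truncated to s, t ≤ i (the left one also
-- has a term at t = -1, with factor C(d-2, 0)). For d ≤ 1 the inequality holds term by term.
-- For d ≥ 2, group the terms (s, t) and (t, s): after clearing denominators a pair favours the
-- right-hand side iff a polynomial is positive, and this polynomial grows as the pair moves
-- towards the diagonal, so the contributions of the pairs, ordered from the diagonal outwards,
-- change sign at most once. Their partial sums start ≥ 0 and end at 0, because without
-- truncation the two sides agree (Σ β_d β_d = Σ β_{d-2} β_{d+2}); with a single sign change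
-- they stay ≥ 0 in between.

open import Defs
open import Data.Nat using (ℕ; _≤_; _/_; _*_)
open import Data.Integer using (+_; -[1+_]) renaming (_+_ to _+ℤ_; _-_ to _-ℤ_; _*_ to _*ℤ_)
import Data.Integer.Tactic.RingSolver as ℤ
open import Data.Bool.Base using (true; false; if_then_else_)
open import Data.Empty using (⊥-elim)
open import Data.List.Base using (List; []; _∷_; _++_; map; filter; concatMap; upTo; applyUpTo)
open import Data.List.Properties using (map-++; map-∘; map-upTo)
open import Data.Nat.Base
open import Data.Nat.Combinatorics using (_C_; nCk+nC[k+1]≡[n+1]C[k+1]; nC1≡n)
open import Data.Nat.DivMod using (m/n*n≤m)
open import Data.Nat.ListAction using (sum)
open import Data.Nat.ListAction.Properties using (sum-++)
open import Data.Nat.Properties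
open import Data.Nat.Tactic.RingSolver using (solve-∀)
open import Data.Product.Base using (_×_; _,_; proj₁; proj₂)
open import Data.Sum.Base using (_⊎_; inj₁; inj₂)
open import Function.Base using (_∘_)
open import Level using (0ℓ)
open import Relation.Binary.PropositionalEquality
open import Relation.Nullary using (yes; no; does)
open import Relation.Unary using (Pred; Decidable)
open import Algebra.Properties.CommutativeSemigroup +-commutativeSemigroup using () renaming (interchange to +-interchange)
open import Algebra.Properties.CommutativeSemigroup *-commutativeSemigroup using () renaming (interchange to *-interchange)
open ≤-Reasoning

double : ℕ → ℕ
double zero    = zero
double (suc n) = suc (suc (double n))

double≡n+n : ∀ n → double n ≡ n + n
double≡n+n zero    = refl
double≡n+n (suc n) = cong suc (trans (cong suc (double≡n+n n)) (sym (+-suc n n)))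

double-+-suc-suc : ∀ n m → double n + suc (suc m) ≡ double (suc n) + m
double-+-suc-suc n m = trans (+-suc (double n) (suc m)) (cong suc (+-suc (double n) m))

pascal : ∀ n k → suc n C suc k ≡ n C k + n C suc k
pascal n k = sym (nCk+nC[k+1]≡[n+1]C[k+1] n k)

-- The absorption identity (k+1) C(n,k+1) = (n-k) C(n,k), with the truncated subtraction moved across.
absorption : ∀ n k → suc k * (n C suc k) + k * (n C k) ≡ n * (n C k)
absorption zero    zero    = refl
absorption zero    (suc k) = cong₂ _+_ (*-zeroʳ (suc (suc k))) (*-zeroʳ (suc k))
absorption (suc n) zero    =
  trans (+-identityʳ _) (trans (*-identityˡ _) (trans (nC1≡n (suc n)) (sym (*-identityʳ (suc n)))))
absorption (suc n) (suc k) = begin-equality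
  suc (suc k) * (suc n C suc (suc k)) + suc k * (suc n C suc k)
    ≡⟨ cong₂ (λ u v → suc (suc k) * u + suc k * v) (pascal n (suc k)) (pascal n k) ⟩
  suc (suc k) * (y + z) + suc k * (x + y)
    ≡⟨ regroup k x y z ⟩
  (suc (suc k) * z + suc k * y) + (suc k * y + k * x) + (x + y)
    ≡⟨ cong₂ (λ u v → u + v + (x + y)) (absorption n (suc k)) (absorption n k) ⟩
  n * y + n * x + (x + y)
    ≡⟨ collect n x y ⟩
  suc n * (x + y)
    ≡⟨ cong (suc n *_) (pascal n k) ⟨
  suc n * (suc n C suc k) ∎
  where
  x y z : ℕ
  x = n C k
  y = n C suc k
  z = n C suc (suc k)
  regroup : ∀ k x y z → suc (suc k) * (y + z) + suc k * (x + y)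
                      ≡ (suc (suc k) * z + suc k * y) + (suc k * y + k * x) + (x + y)
  regroup = solve-∀
  collect : ∀ n x y → n * y + n * x + (x + y) ≡ suc n * (x + y)
  collect = solve-∀

nCk>0 : ∀ {n k} → k ≤ n → 0 < n C k
nCk>0 {n}     {zero}  _         = z<s
nCk>0 {suc n} {suc k} (s≤s k≤n) =
  subst (0 <_) (sym (pascal n k)) (<-≤-trans (nCk>0 k≤n) (m≤m+n (n C k) (n C suc k)))

-- With n = 2i + d and s = i - j, the paper's C(n-2j, i-j), C(n-2j, i-1-j), C(n-2j, i+1-j)
-- become β d s, β⁻ d s, β⁺ d s.
β β⁻ β⁺ : ℕ → ℕ → ℕ
β  d s = (double s + d) C s
β⁻ d zero    = 0
β⁻ d (suc s) = (double (suc s) + d) C s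
β⁺ d s = (double s + d) C suc s

β>0 : ∀ d s → 0 < β d s
β>0 d s = nCk>0 (≤-trans (m≤m+n s s) (≤-trans (≤-reflexive (sym (double≡n+n s))) (m≤m+n (double s) d)))

β⁻*[1+s+d] : ∀ d s → β⁻ d s * suc (s + d) ≡ s * β d s
β⁻*[1+s+d] d zero    = refl
β⁻*[1+s+d] d (suc s) = +-cancelʳ-≡ (s * x) _ _ (begin-equality
  x * suc (suc s + d) + s * x  ≡⟨ expand s d x ⟩
  (suc s + suc s + d) * x      ≡⟨ cong (λ m → (m + d) * x) (double≡n+n (suc s)) ⟨
  n * x                        ≡⟨ absorption n s ⟨
  suc s * β d (suc s) + s * x  ∎)
  where
  n x : ℕ
  n = double (suc s) + d
  x = n C s
  expand : ∀ s d x → x * suc (suc s + d) + s * x ≡ (suc s + suc s + d) * x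
  expand = solve-∀

β⁺*[1+t] : ∀ d t → β⁺ d t * suc t ≡ (t + d) * β d t
β⁺*[1+t] d t = +-cancelʳ-≡ (t * y) _ _ (begin-equality
  β⁺ d t * suc t + t * y  ≡⟨ cong (_+ t * y) (*-comm (β⁺ d t) (suc t)) ⟩
  suc t * β⁺ d t + t * y  ≡⟨ absorption n t ⟩
  n * y                   ≡⟨ cong (λ m → (m + d) * y) (double≡n+n t) ⟩
  (t + t + d) * y         ≡⟨ split t d y ⟩
  (t + d) * y + t * y     ∎)
  where
  n y : ℕ
  n = double t + d
  y = β d t
  split : ∀ t d y → (t + t + d) * y ≡ (t + d) * y + t * y
  split = solve-∀

β⁻-suc : ∀ d s → β⁻ d (suc s) ≡ β (suc (suc d)) s
β⁻-suc d s = cong (_C s) (sym (double-+-suc-suc s d))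

β⁺≡β-suc : ∀ d t → β⁺ (suc (suc d)) t ≡ β d (suc t)
β⁺≡β-suc d t = cong (_C suc t) (double-+-suc-suc t d)

≤-by-ratio : ∀ {x X} m p .{{_ : NonZero p}} → x * p ≡ m * X → m ≤ p → x ≤ X
≤-by-ratio {x} {X} m p x*p≡m*X m≤p = *-cancelʳ-≤ x X p (begin
  x * p  ≡⟨ x*p≡m*X ⟩
  m * X  ≤⟨ *-monoˡ-≤ X m≤p ⟩
  p * X  ≡⟨ *-comm p X ⟩
  X * p  ∎)

β⁻≤β : ∀ d s → β⁻ d s ≤ β d s
β⁻≤β d s = ≤-by-ratio s (suc (s + d)) (β⁻*[1+s+d] d s) (≤-trans (m≤m+n s d) (n≤1+n (s + d)))

β⁺≤β : ∀ {d} t → d ≤ 1 → β⁺ d t ≤ β d t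
β⁺≤β {d} t d≤1 =
  ≤-by-ratio (t + d) (suc t) (β⁺*[1+t] d t) (≤-trans (+-monoʳ-≤ t d≤1) (≤-reflexive (+-comm t 1)))

β⁻β⁺≤ββ : ∀ d {s t} → s ≤ suc t → β⁻ d s * β⁺ d t ≤ β d s * β d t
β⁻β⁺≤ββ d {s} {t} s≤1+t = ≤-by-ratio (s * (t + d)) (suc (s + d) * suc t) scaled bound
  where
  scaled : β⁻ d s * β⁺ d t * (suc (s + d) * suc t) ≡ s * (t + d) * (β d s * β d t)
  scaled = begin-equality
    β⁻ d s * β⁺ d t * (suc (s + d) * suc t)      ≡⟨ *-interchange (β⁻ d s) (β⁺ d t) _ _ ⟩
    β⁻ d s * suc (s + d) * (β⁺ d t * suc t)      ≡⟨ cong₂ _*_ (β⁻*[1+s+d] d s) (β⁺*[1+t] d t) ⟩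
    s * β d s * ((t + d) * β d t)                ≡⟨ *-interchange s (β d s) _ _ ⟩
    s * (t + d) * (β d s * β d t)                ∎
  bound : s * (t + d) ≤ suc (s + d) * suc t
  bound = begin
    s * (t + d)                           ≡⟨ *-distribˡ-+ s t d ⟩
    s * t + s * d                         ≤⟨ +-monoʳ-≤ (s * t) (*-monoˡ-≤ d s≤1+t) ⟩
    s * t + suc t * d                     ≤⟨ m≤m+n (s * t + suc t * d) (suc (s + t)) ⟩
    s * t + suc t * d + suc (s + t)       ≡⟨ expand s t d ⟩
    suc (s + d) * suc t                   ∎
    where
    expand : ∀ s t d → s * t + suc t * d + suc (s + t) ≡ suc (s + d) * suc t
    expand = solve-∀

cross diag : ℕ → ℕ → ℕ → ℕ
cross d s t = β⁻ d s * β⁺ d t + β⁻ d t * β⁺ d s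
diag  d s t = β d s * β d t + β d t * β d s

-- Clearing the denominators of the ratios β⁻/β and β⁺/β turns cross < diag into crossPoly < 2 denom.
denom crossPoly : ℕ → ℕ → ℕ → ℕ
denom d s t = suc (s + d) * suc s * (suc (t + d) * suc t)
crossPoly d s t = s * suc s * ((t + d) * suc (t + d)) + t * suc t * ((s + d) * suc (s + d))

cross*denom : ∀ d s t → cross d s t * denom d s t ≡ β d s * β d t * crossPoly d s t
cross*denom d s t = begin-equality
  cross d s t * denom d s t
    ≡⟨ regroup (β⁻ d s) (β⁺ d t) (β⁻ d t) (β⁺ d s) (suc (s + d)) (suc s) (suc (t + d)) (suc t) ⟩
  (β⁻ d s * suc (s + d)) * (β⁺ d t * suc t) * (suc s * suc (t + d))
    + (β⁻ d t * suc (t + d)) * (β⁺ d s * suc s) * (suc t * suc (s + d))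
    ≡⟨ cong₂ (λ u v → u * (suc s * suc (t + d)) + v * (suc t * suc (s + d)))
             (cong₂ _*_ (β⁻*[1+s+d] d s) (β⁺*[1+t] d t)) (cong₂ _*_ (β⁻*[1+s+d] d t) (β⁺*[1+t] d s)) ⟩
  (s * β d s) * ((t + d) * β d t) * (suc s * suc (t + d))
    + (t * β d t) * ((s + d) * β d s) * (suc t * suc (s + d))
    ≡⟨ collect d s t (β d s) (β d t) ⟩
  β d s * β d t * crossPoly d s t ∎
  where
  regroup : ∀ gs ht gt hs a b c e → (gs * ht + gt * hs) * (a * b * (c * e))
          ≡ (gs * a) * (ht * e) * (b * c) + (gt * c) * (hs * b) * (e * a)
  regroup = solve-∀
  collect : ∀ d s t x y →
            (s * x) * ((t + d) * y) * (suc s * suc (t + d)) + (t * y) * ((s + d) * x) * (suc t * suc (s + d))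
          ≡ x * y * (s * suc s * ((t + d) * suc (t + d)) + t * suc t * ((s + d) * suc (s + d)))
  collect = solve-∀

diag*denom : ∀ d s t → diag d s t * denom d s t ≡ β d s * β d t * (2 * denom d s t)
diag*denom d s t = rearrange (β d s) (β d t) (denom d s t)
  where
  rearrange : ∀ x y D → (x * y + y * x) * D ≡ x * y * (2 * D)
  rearrange = solve-∀

cross<diag⇒crossPoly<2denom : ∀ d s t → cross d s t < diag d s t → crossPoly d s t < 2 * denom d s t
cross<diag⇒crossPoly<2denom d s t lt = *-cancelˡ-< (β d s * β d t) _ _
  (subst₂ _<_ (cross*denom d s t) (diag*denom d s t) (*-monoˡ-< (denom d s t) lt))

crossPoly<2denom⇒cross<diag : ∀ d s t → crossPoly d s t < 2 * denom d s t → cross d s t < diag d s t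
crossPoly<2denom⇒cross<diag d s t lt = *-cancelʳ-< (denom d s t) _ _
  (subst₂ _<_ (sym (cross*denom d s t)) (sym (diag*denom d s t)) (*-monoʳ-< (β d s * β d t) {{ββ≢0}} lt))
  where
  ββ≢0 : NonZero (β d s * β d t)
  ββ≢0 = >-nonZero (*-mono-< (β>0 d s) (β>0 d t))

-- 2 denom − crossPoly grows by u (4 + 4t + 2u + 2d + 4d²) when (u + t + 1, t) moves to (u + t, t + 1).
crossPoly<2denom-inward : ∀ d t u → crossPoly d (suc (u + t)) t < 2 * denom d (suc (u + t)) t
                                  → crossPoly d (u + t) (suc t) < 2 * denom d (u + t) (suc t)
crossPoly<2denom-inward d t u lt = +-cancelˡ-< P N' P' (begin-strict
  P + N'          ≤⟨ m≤m+n (P + N') (u * (4 + 4 * t + 2 * u + 2 * d + 4 * d * d)) ⟩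
  P + N' + _      ≡⟨ balance d t u ⟨
  P' + N          <⟨ +-monoʳ-< P' lt ⟩
  P' + P          ≡⟨ +-comm P' P ⟩
  P + P'          ∎)
  where
  N P N' P' : ℕ
  N  = crossPoly d (suc (u + t)) t
  P  = 2 * denom d (suc (u + t)) t
  N' = crossPoly d (u + t) (suc t)
  P' = 2 * denom d (u + t) (suc t)
  balance : ∀ d t u →
      2 * (suc (u + t + d) * suc (u + t) * (suc (suc t + d) * suc (suc t)))
    + ((suc (u + t)) * suc (suc (u + t)) * ((t + d) * suc (t + d)) + t * suc t * ((suc (u + t) + d) * suc (suc (u + t) + d)))
    ≡ 2 * (suc (suc (u + t) + d) * suc (suc (u + t)) * (suc (t + d) * suc t))
    + ((u + t) * suc (u + t) * ((suc t + d) * suc (suc t + d)) + suc t * suc (suc t) * ((u + t + d) * suc (u + t + d)))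
    + u * (4 + 4 * t + 2 * u + 2 * d + 4 * d * d)
  balance = solve-∀

sumUpTo : ℕ → (ℕ → ℕ) → ℕ
sumUpTo n χ = sum (applyUpTo χ n)

sumUpTo-cong : ∀ n {χ χ′} → (∀ j → j < n → χ j ≡ χ′ j) → sumUpTo n χ ≡ sumUpTo n χ′
sumUpTo-cong zero    eq = refl
sumUpTo-cong (suc n) eq = cong₂ _+_ (eq 0 z<s) (sumUpTo-cong n (λ j j<n → eq (suc j) (s<s j<n)))

sumUpTo-zero : ∀ n → sumUpTo n (λ _ → 0) ≡ 0
sumUpTo-zero zero    = refl
sumUpTo-zero (suc n) = sumUpTo-zero n

conv : (ℕ → ℕ) → (ℕ → ℕ) → ℕ → ℕ
conv φ ψ zero    = φ 0 * ψ 0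
conv φ ψ (suc r) = φ 0 * ψ (suc r) + conv (φ ∘ suc) ψ r

conv≡sumUpTo : ∀ φ ψ r → conv φ ψ r ≡ sumUpTo (suc r) (λ j → φ j * ψ (r ∸ j))
conv≡sumUpTo φ ψ zero    = sym (+-identityʳ (φ 0 * ψ 0))
conv≡sumUpTo φ ψ (suc r) = cong (_+_ (φ 0 * ψ (suc r))) (conv≡sumUpTo (φ ∘ suc) ψ r)

conv-cong : ∀ {φ φ′ ψ ψ′} r → (∀ j → j ≤ r → φ j * ψ (r ∸ j) ≡ φ′ j * ψ′ (r ∸ j)) →
            conv φ ψ r ≡ conv φ′ ψ′ r
conv-cong zero    eq = eq 0 z≤n
conv-cong (suc r) eq = cong₂ _+_ (eq 0 z≤n) (conv-cong r (λ j j≤r → eq (suc j) (s≤s j≤r)))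

conv-mono : ∀ {φ φ′ ψ ψ′} r → (∀ j → j ≤ r → φ j * ψ (r ∸ j) ≤ φ′ j * ψ′ (r ∸ j)) →
            conv φ ψ r ≤ conv φ′ ψ′ r
conv-mono zero    le = le 0 z≤n
conv-mono (suc r) le = +-mono-≤ (le 0 z≤n) (conv-mono r (λ j j≤r → le (suc j) (s≤s j≤r)))

conv-zeroˡ : ∀ {φ} ψ r → (∀ j → φ j ≡ 0) → conv φ ψ r ≡ 0
conv-zeroˡ ψ zero    φ≡0 = cong (_* ψ 0) (φ≡0 0)
conv-zeroˡ ψ (suc r) φ≡0 = cong₂ _+_ (cong (_* ψ (suc r)) (φ≡0 0)) (conv-zeroˡ ψ r (φ≡0 ∘ suc))

conv-+ˡ : ∀ φ₁ φ₂ ψ r → conv (λ j → φ₁ j + φ₂ j) ψ r ≡ conv φ₁ ψ r + conv φ₂ ψ r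
conv-+ˡ φ₁ φ₂ ψ zero    = *-distribʳ-+ (ψ 0) (φ₁ 0) (φ₂ 0)
conv-+ˡ φ₁ φ₂ ψ (suc r) = trans
  (cong₂ _+_ (*-distribʳ-+ (ψ (suc r)) (φ₁ 0) (φ₂ 0)) (conv-+ˡ (φ₁ ∘ suc) (φ₂ ∘ suc) ψ r))
  (+-interchange (φ₁ 0 * ψ (suc r)) (φ₂ 0 * ψ (suc r)) (conv (φ₁ ∘ suc) ψ r) (conv (φ₂ ∘ suc) ψ r))

conv-+ʳ : ∀ φ ψ₁ ψ₂ r → conv φ (λ t → ψ₁ t + ψ₂ t) r ≡ conv φ ψ₁ r + conv φ ψ₂ r
conv-+ʳ φ ψ₁ ψ₂ zero    = *-distribˡ-+ (φ 0) (ψ₁ 0) (ψ₂ 0)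
conv-+ʳ φ ψ₁ ψ₂ (suc r) = trans
  (cong₂ _+_ (*-distribˡ-+ (φ 0) (ψ₁ (suc r)) (ψ₂ (suc r))) (conv-+ʳ (φ ∘ suc) ψ₁ ψ₂ r))
  (+-interchange (φ 0 * ψ₁ (suc r)) (φ 0 * ψ₂ (suc r)) (conv (φ ∘ suc) ψ₁ r) (conv (φ ∘ suc) ψ₂ r))

conv-snoc : ∀ φ ψ r → conv φ ψ (suc r) ≡ conv φ (ψ ∘ suc) r + φ (suc r) * ψ 0
conv-snoc φ ψ zero    = refl
conv-snoc φ ψ (suc r) = begin-equality
  φ 0 * ψ (suc (suc r)) + conv (φ ∘ suc) ψ (suc r)
    ≡⟨ cong (_+_ (φ 0 * ψ (suc (suc r)))) (conv-snoc (φ ∘ suc) ψ r) ⟩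
  φ 0 * ψ (suc (suc r)) + (conv (φ ∘ suc) (ψ ∘ suc) r + φ (suc (suc r)) * ψ 0)
    ≡⟨ +-assoc (φ 0 * ψ (suc (suc r))) (conv (φ ∘ suc) (ψ ∘ suc) r) (φ (suc (suc r)) * ψ 0) ⟨
  conv φ (ψ ∘ suc) (suc r) + φ (suc (suc r)) * ψ 0 ∎

outer : (ℕ → ℕ) → (ℕ → ℕ) → ℕ → ℕ
outer φ ψ r = φ 0 * ψ (suc (suc r)) + φ (suc (suc r)) * ψ 0

outer-≡ : ∀ φ ψ r {x y z w} → φ 0 ≡ x → ψ (suc (suc r)) ≡ y → φ (suc (suc r)) ≡ z → ψ 0 ≡ w →
          outer φ ψ r ≡ x * y + z * w
outer-≡ φ ψ r refl refl refl refl = refl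

conv-peel : ∀ φ ψ r → conv φ ψ (suc (suc r)) ≡ conv (φ ∘ suc) (ψ ∘ suc) r + outer φ ψ r
conv-peel φ ψ r = begin-equality
  φ 0 * ψ (suc (suc r)) + conv (φ ∘ suc) ψ (suc r)
    ≡⟨ cong (_+_ (φ 0 * ψ (suc (suc r)))) (conv-snoc (φ ∘ suc) ψ r) ⟩
  φ 0 * ψ (suc (suc r)) + (conv (φ ∘ suc) (ψ ∘ suc) r + φ (suc (suc r)) * ψ 0)
    ≡⟨ rotate (φ 0 * ψ (suc (suc r))) (conv (φ ∘ suc) (ψ ∘ suc) r) (φ (suc (suc r)) * ψ 0) ⟩
  conv (φ ∘ suc) (ψ ∘ suc) r + outer φ ψ r ∎
  where
  rotate : ∀ a b c → a + (b + c) ≡ b + (a + c)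
  rotate = solve-∀

delay : (ℕ → ℕ) → ℕ → ℕ
delay χ zero    = 0
delay χ (suc t) = χ t

conv-delayʳ : ∀ φ ψ r → conv φ (delay ψ) (suc r) ≡ conv φ ψ r
conv-delayʳ φ ψ r =
  trans (conv-snoc φ (delay ψ) r) (trans (cong (_+_ (conv φ ψ r)) (*-zeroʳ (φ (suc r)))) (+-identityʳ _))

β-pascal : ∀ b t → β (suc b) t ≡ β b t + delay (β (suc (suc b))) t
β-pascal b zero    = refl
β-pascal b (suc t) = begin-equality
  (double (suc t) + suc b) C suc t
    ≡⟨ cong (_C suc t) (+-suc (double (suc t)) b) ⟩
  suc (double (suc t) + b) C suc t
    ≡⟨ pascal (double (suc t) + b) t ⟩
  (double (suc t) + b) C t + (double (suc t) + b) C suc t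
    ≡⟨ +-comm ((double (suc t) + b) C t) _ ⟩
  β b (suc t) + (double (suc t) + b) C t
    ≡⟨ cong (λ m → β b (suc t) + m C t) (double-+-suc-suc t b) ⟨
  β b (suc t) + β (suc (suc b)) t ∎

-- A Vandermonde-type identity: as power series, β-pascal reads β_{b+1} = β_b + x β_{b+2}.
conv-β-shift : ∀ N a b → conv (β a) (β (suc b)) N ≡ conv (β (suc a)) (β b) N
conv-β-shift zero    a b = refl
conv-β-shift (suc N) a b = begin-equality
  conv (β a) (β (suc b)) (suc N)
    ≡⟨ conv-cong {β a} {β a} {β (suc b)} {λ t → β b t + delay (β (suc (suc b))) t} (suc N)
                 (λ j _ → cong (β a j *_) (β-pascal b (suc N ∸ j))) ⟩
  conv (β a) (λ t → β b t + delay (β (suc (suc b))) t) (suc N)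
    ≡⟨ conv-+ʳ (β a) (β b) (delay (β (suc (suc b)))) (suc N) ⟩
  conv (β a) (β b) (suc N) + conv (β a) (delay (β (suc (suc b)))) (suc N)
    ≡⟨ cong (_+_ (conv (β a) (β b) (suc N))) (conv-delayʳ (β a) (β (suc (suc b))) N) ⟩
  conv (β a) (β b) (suc N) + conv (β a) (β (suc (suc b))) N
    ≡⟨ cong (_+_ (conv (β a) (β b) (suc N)))
            (trans (conv-β-shift N a (suc b)) (conv-β-shift N (suc a) b)) ⟩
  conv (β a) (β b) (suc N) + conv (delay (β (suc (suc a)))) (β b) (suc N)
    ≡⟨ conv-+ˡ (β a) (delay (β (suc (suc a)))) (β b) (suc N) ⟨
  conv (λ j → β a j + delay (β (suc (suc a))) j) (β b) (suc N)
    ≡⟨ conv-cong {β (suc a)} {λ j → β a j + delay (β (suc (suc a))) j} {β b} {β b} (suc N)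
                 (λ j _ → cong (_* β b (suc N ∸ j)) (β-pascal a j)) ⟨
  conv (β (suc a)) (β b) (suc N) ∎

-- If δL - δR changes sign at most once, from positive to non-positive, then L - R ≥ 0 at 0
-- and at m + k forces L - R ≥ 0 at k.
module SingleCrossing (R L δR δL : ℕ → ℕ)
  (R-suc : ∀ k → R (suc k) ≡ R k + δR k) (L-suc : ∀ k → L (suc k) ≡ L k + δL k)
  (inward : ∀ k → δR (suc k) < δL (suc k) → δR k < δL k)
  (R₀≤L₀ : R 0 ≤ L 0) where

  private
    R≤L-suc : ∀ {k} → R k ≤ L k → δR k ≤ δL k → R (suc k) ≤ L (suc k)
    R≤L-suc {k} R≤L δR≤δL = begin
      R (suc k)    ≡⟨ R-suc k ⟩
      R k + δR k   ≤⟨ +-mono-≤ R≤L δR≤δL ⟩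
      L k + δL k   ≡⟨ L-suc k ⟨
      L (suc k)    ∎

    R≤L-if-δR<δL : ∀ k → δR k < δL k → R k ≤ L k
    R≤L-if-δR<δL zero    _     = R₀≤L₀
    R≤L-if-δR<δL (suc k) δ<δ′ = R≤L-suc (R≤L-if-δR<δL k (inward k δ<δ′)) (<⇒≤ (inward k δ<δ′))

    R≤L-pred : ∀ k → R (suc k) ≤ L (suc k) → R k ≤ L k
    R≤L-pred k R≤L with δL k ≤? δR k
    ... | no  δL≰δR = R≤L-if-δR<δL k (≰⇒> δL≰δR)
    ... | yes δL≤δR = +-cancelʳ-≤ (δR k) (R k) (L k) (begin
      R k + δR k   ≡⟨ R-suc k ⟨
      R (suc k)    ≤⟨ R≤L ⟩
      L (suc k)    ≡⟨ L-suc k ⟩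
      L k + δL k   ≤⟨ +-monoʳ-≤ (L k) δL≤δR ⟩
      L k + δR k   ∎)

  R≤L-downwards : ∀ m k → R (m + k) ≤ L (m + k) → R k ≤ L k
  R≤L-downwards zero    k R≤L = R≤L
  R≤L-downwards (suc m) k R≤L = R≤L-downwards m k (R≤L-pred (m + k) R≤L)

sum-map-filter : ∀ {A : Set} {P : Pred A 0ℓ} (P? : Decidable P) (F : A → ℕ) xs →
                 sum (map F (filter P? xs)) ≡ sum (map (λ x → if does (P? x) then F x else 0) xs)
sum-map-filter P? F []       = refl
sum-map-filter P? F (x ∷ xs) with does (P? x)
... | true  = cong (_+_ (F x)) (sum-map-filter P? F xs)
... | false = sum-map-filter P? F xs

sum-map-concatMap : ∀ {A B : Set} (F : B → ℕ) (G : A → List B) xs →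
                    sum (map F (concatMap G xs)) ≡ sum (map (sum ∘ map F ∘ G) xs)
sum-map-concatMap F G []       = refl
sum-map-concatMap F G (x ∷ xs) = begin-equality
  sum (map F (G x ++ concatMap G xs))
    ≡⟨ cong sum (map-++ F (G x) (concatMap G xs)) ⟩
  sum (map F (G x) ++ map F (concatMap G xs))
    ≡⟨ sum-++ (map F (G x)) (map F (concatMap G xs)) ⟩
  sum (map F (G x)) + sum (map F (concatMap G xs))
    ≡⟨ cong (_+_ (sum (map F (G x)))) (sum-map-concatMap F G xs) ⟩
  sum (map (sum ∘ map F ∘ G) (x ∷ xs)) ∎

sumUpTo-cutoff : ∀ {K χ} → (∀ j → K ≤ j → χ j ≡ 0) → ∀ n → K ≤ n → sumUpTo n χ ≡ sumUpTo K χ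
sumUpTo-cutoff {zero}      χ≡0 n       _         = trans (sumUpTo-cong n (λ j _ → χ≡0 j z≤n)) (sumUpTo-zero n)
sumUpTo-cutoff {suc K} {χ} χ≡0 (suc n) (s≤s K≤n) =
  cong (_+_ (χ 0)) (sumUpTo-cutoff {K} {χ ∘ suc} (λ j K≤j → χ≡0 (suc j) (s≤s K≤j)) n K≤n)

sumUpTo-indicator : ∀ M r (x : ℕ → ℕ) → (∀ k → M ≤ k → x k ≡ 0) →
                    sumUpTo M (λ k → if k ≡ᵇ r then x k else 0) ≡ x r
sumUpTo-indicator zero    r       x x≡0 = sym (x≡0 r z≤n)
sumUpTo-indicator (suc M) zero    x x≡0 = trans (cong (_+_ (x 0)) (sumUpTo-zero M)) (+-identityʳ (x 0))
sumUpTo-indicator (suc M) (suc r) x x≡0 = sumUpTo-indicator M r (x ∘ suc) (λ k M≤k → x≡0 (suc k) (s≤s M≤k))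

sumUpTo-shifted-indicator : ∀ M {j r} (x : ℕ → ℕ) → j ≤ r → (∀ k → M ≤ k → x k ≡ 0) →
                            sumUpTo M (λ k → if j + k ≡ᵇ r then x k else 0) ≡ x (r ∸ j)
sumUpTo-shifted-indicator M {r = r} x z≤n       x≡0 = sumUpTo-indicator M r x x≡0
sumUpTo-shifted-indicator M         x (s≤s j≤r) x≡0 = sumUpTo-shifted-indicator M x j≤r x≡0

sumUpTo-shifted-indicator-none : ∀ M {j r} (x : ℕ → ℕ) → r < j →
                                 sumUpTo M (λ k → if j + k ≡ᵇ r then x k else 0) ≡ 0
sumUpTo-shifted-indicator-none M {suc j} {zero}  x _         = sumUpTo-zero M
sumUpTo-shifted-indicator-none M {suc j} {suc r} x (s≤s r<j) = sumUpTo-shifted-indicator-none M x r<j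

sumPairs≡conv : ∀ m r φ ψ → (∀ j → m < j → φ j ≡ 0) → (∀ k → m < k → ψ k ≡ 0) →
                sumPairs m r (λ j k → φ j * ψ k) ≡ conv φ ψ r
sumPairs≡conv m r φ ψ φ≡0 ψ≡0 = begin-equality
  sumPairs m r (λ j k → φ j * ψ k)
    ≡⟨ sum-map-filter (λ p → proj₁ p + proj₂ p ≟ r) _ (concatMap row (upTo M)) ⟩
  sum (map H (concatMap row (upTo M)))
    ≡⟨ sum-map-concatMap H row (upTo M) ⟩
  sum (map (sum ∘ map H ∘ row) (upTo M))
    ≡⟨ cong sum (map-upTo (sum ∘ map H ∘ row) M) ⟩
  sumUpTo M (sum ∘ map H ∘ row)
    ≡⟨ sumUpTo-cong M {sum ∘ map H ∘ row} {ω}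
                    (λ j _ → cong sum (trans (sym (map-∘ (upTo M))) (map-upTo _ M))) ⟩
  sumUpTo M ω
    ≡⟨ truncate (≤-total M (suc r)) ⟩
  sumUpTo (suc r) ω
    ≡⟨ sumUpTo-cong (suc r) {ω} (λ j j<1+r → ω-≤ (≤-pred j<1+r)) ⟩
  sumUpTo (suc r) (λ j → φ j * ψ (r ∸ j))
    ≡⟨ conv≡sumUpTo φ ψ r ⟨
  conv φ ψ r ∎
  where
  M : ℕ
  M = suc m
  row : ℕ → List (ℕ × ℕ)
  row j = map (j ,_) (upTo M)
  H : ℕ × ℕ → ℕ
  H p = if proj₁ p + proj₂ p ≡ᵇ r then φ (proj₁ p) * ψ (proj₂ p) else 0
  ω : ℕ → ℕ
  ω j = sumUpTo M (λ k → if j + k ≡ᵇ r then φ j * ψ k else 0)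
  ω-≤ : ∀ {j} → j ≤ r → ω j ≡ φ j * ψ (r ∸ j)
  ω-≤ {j} j≤r = sumUpTo-shifted-indicator M (λ k → φ j * ψ k) j≤r
                  (λ k M≤k → trans (cong (_*_ (φ j)) (ψ≡0 k M≤k)) (*-zeroʳ (φ j)))
  ω-> : ∀ {j} → r < j → ω j ≡ 0
  ω-> {j} r<j = sumUpTo-shifted-indicator-none M (λ k → φ j * ψ k) r<j
  ω-vanish : ∀ j → M ≤ j → ω j ≡ 0
  ω-vanish j M≤j with j ≤? r
  ... | yes j≤r = trans (ω-≤ j≤r) (cong (_* ψ (r ∸ j)) (φ≡0 j M≤j))
  ... | no  j≰r = ω-> (≰⇒> j≰r)
  truncate : M ≤ suc r ⊎ suc r ≤ M → sumUpTo M ω ≡ sumUpTo (suc r) ω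
  truncate (inj₁ M≤1+r) = sym (sumUpTo-cutoff ω-vanish (suc r) M≤1+r)
  truncate (inj₂ 1+r≤M) = sumUpTo-cutoff (λ j 1+r≤j → ω-> 1+r≤j) M 1+r≤M

term₀ term₋ term₊ : ℕ → ℕ → ℕ → ℕ
term₀ n i j = binom (+ n -ℤ + 2 *ℤ + j) (+ i -ℤ + j)
term₋ n i j = binom (+ n -ℤ + 2 *ℤ + j) (+ i -ℤ + 1 -ℤ + j)
term₊ n i j = binom (+ n -ℤ + 2 *ℤ + j) (+ i +ℤ + 1 -ℤ + j)

private
  upper-suc : ∀ p q → (+ 2 +ℤ p) -ℤ + 2 *ℤ (+ 1 +ℤ q) ≡ p -ℤ + 2 *ℤ q
  upper-suc = ℤ.solve-∀
  upper-zero : ∀ p → p -ℤ + 2 *ℤ + 0 ≡ p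
  upper-zero = ℤ.solve-∀

binom-neg : ∀ x m → binom x -[1+ m ] ≡ 0
binom-neg (+ _)    _ = refl
binom-neg -[1+ _ ] _ = refl

term₀-suc : ∀ n i j → term₀ (suc (suc n)) (suc i) (suc j) ≡ term₀ n i j
term₀-suc n i j = cong₂ binom (upper-suc (+ n) (+ j)) (lower (+ i) (+ j))
  where
  lower : ∀ p q → (+ 1 +ℤ p) -ℤ (+ 1 +ℤ q) ≡ p -ℤ q
  lower = ℤ.solve-∀

term₋-suc : ∀ n i j → term₋ (suc (suc n)) (suc i) (suc j) ≡ term₋ n i j
term₋-suc n i j = cong₂ binom (upper-suc (+ n) (+ j)) (lower (+ i) (+ j))
  where
  lower : ∀ p q → (+ 1 +ℤ p) -ℤ + 1 -ℤ (+ 1 +ℤ q) ≡ p -ℤ + 1 -ℤ q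
  lower = ℤ.solve-∀

term₊-suc : ∀ n i j → term₊ (suc (suc n)) (suc i) (suc j) ≡ term₊ n i j
term₊-suc n i j = cong₂ binom (upper-suc (+ n) (+ j)) (lower (+ i) (+ j))
  where
  lower : ∀ p q → (+ 1 +ℤ p) +ℤ + 1 -ℤ (+ 1 +ℤ q) ≡ p +ℤ + 1 -ℤ q
  lower = ℤ.solve-∀

term₀-zero : ∀ n i → term₀ n i 0 ≡ n C i
term₀-zero n i = cong₂ binom (upper-zero (+ n)) (lower (+ i))
  where
  lower : ∀ p → p -ℤ + 0 ≡ p
  lower = ℤ.solve-∀

term₋-zero : ∀ n i → term₋ n (suc i) 0 ≡ n C i
term₋-zero n i = cong₂ binom (upper-zero (+ n)) (lower (+ i))
  where
  lower : ∀ p → (+ 1 +ℤ p) -ℤ + 1 -ℤ + 0 ≡ p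
  lower = ℤ.solve-∀

term₊-zero : ∀ n i → term₊ n i 0 ≡ n C suc i
term₊-zero n i = cong₂ binom (upper-zero (+ n)) (lower (+ i))
  where
  lower : ∀ p → p +ℤ + 1 -ℤ + 0 ≡ + 1 +ℤ p
  lower = ℤ.solve-∀

term₊-top-narrow : ∀ {d} → d ≤ 1 → term₊ d 0 1 ≡ 0
term₊-top-narrow z≤n       = refl
term₊-top-narrow (s≤s z≤n) = refl

module Coefficients (d : ℕ) where

  a b c : ℕ → ℕ → ℕ
  a i = term₀ (double i + d) i
  b i = term₋ (double i + d) i
  c i = term₊ (double i + d) i

  a-≤ : ∀ {i j} → j ≤ i → a i j ≡ β d (i ∸ j)
  a-≤ {i}     {zero}  _         = term₀-zero (double i + d) i
  a-≤ {suc i} {suc j} (s≤s j≤i) = trans (term₀-suc (double i + d) i j) (a-≤ j≤i)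

  a-> : ∀ {i j} → i < j → a i j ≡ 0
  a-> {zero}  {suc j} _         = binom-neg (+ d -ℤ + 2 *ℤ + suc j) j
  a-> {suc i} {suc j} (s≤s i<j) = trans (term₀-suc (double i + d) i j) (a-> i<j)

  b-≤ : ∀ {i j} → j ≤ i → b i j ≡ β⁻ d (i ∸ j)
  b-≤ {zero}  {zero}  _         = binom-neg (+ d -ℤ + 2 *ℤ + 0) 0
  b-≤ {suc i} {zero}  _         = term₋-zero (double (suc i) + d) i
  b-≤ {suc i} {suc j} (s≤s j≤i) = trans (term₋-suc (double i + d) i j) (b-≤ j≤i)

  b-> : ∀ {i j} → i < j → b i j ≡ 0
  b-> {zero}  {suc j} _         = binom-neg (+ d -ℤ + 2 *ℤ + suc j) (suc j)
  b-> {suc i} {suc j} (s≤s i<j) = trans (term₋-suc (double i + d) i j) (b-> i<j)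

  c-≤ : ∀ {i j} → j ≤ i → c i j ≡ β⁺ d (i ∸ j)
  c-≤ {i}     {zero}  _         = term₊-zero (double i + d) i
  c-≤ {suc i} {suc j} (s≤s j≤i) = trans (term₊-suc (double i + d) i j) (c-≤ j≤i)

  -- C(d-2, 0): 1 if d ≥ 2, 0 otherwise.
  c-top : ∀ i → c i (suc i) ≡ term₊ d 0 1
  c-top zero    = refl
  c-top (suc i) = trans (term₊-suc (double i + d) i (suc i)) (c-top i)

  c-> : ∀ {i j} → suc i < j → c i j ≡ 0
  c-> {zero}  {suc zero}    (s≤s ())
  c-> {zero}  {suc (suc j)} _         = binom-neg (+ d -ℤ + 2 *ℤ + suc (suc j)) j
  c-> {suc i} {suc j}       (s≤s i<j) = trans (term₊-suc (double i + d) i j) (c-> i<j)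

  Σaa Σbc δaa δbc : ℕ → ℕ → ℕ
  Σaa i = conv (a i) (a i)
  Σbc i = conv (b i) (c i)
  δaa i = outer (a (suc i)) (a (suc i))
  δbc i = outer (b (suc i)) (c (suc i))

  Σaa-peel : ∀ i r → Σaa (suc i) (suc (suc r)) ≡ Σaa i r + δaa i r
  Σaa-peel i r = trans (conv-peel (a (suc i)) (a (suc i)) r) (cong (_+ δaa i r) (conv-cong r (λ j _ →
    cong₂ _*_ (term₀-suc (double i + d) i j) (term₀-suc (double i + d) i (r ∸ j)))))

  Σbc-peel : ∀ i r → Σbc (suc i) (suc (suc r)) ≡ Σbc i r + δbc i r
  Σbc-peel i r = trans (conv-peel (b (suc i)) (c (suc i)) r) (cong (_+ δbc i r) (conv-cong r (λ j _ →
    cong₂ _*_ (term₋-suc (double i + d) i j) (term₊-suc (double i + d) i (r ∸ j)))))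

  Σbc₀≡0 : ∀ r → Σbc 0 r ≡ 0
  Σbc₀≡0 r = conv-zeroˡ (c 0) r b-0
    where
    b-0 : ∀ j → b 0 j ≡ 0
    b-0 zero    = b-≤ {0} z≤n
    b-0 (suc j) = b-> z<s

  bc≤aa : ∀ i j k → k ≤ i → k ≤ suc j → b i j * c i k ≤ a i j * a i k
  bc≤aa i j k k≤i k≤1+j with j ≤? i
  ... | no  j≰i = subst (λ x → x * c i k ≤ a i j * a i k) (sym (b-> (≰⇒> j≰i))) z≤n
  ... | yes j≤i = subst₂ _≤_ (sym (cong₂ _*_ (b-≤ j≤i) (c-≤ k≤i))) (sym (cong₂ _*_ (a-≤ j≤i) (a-≤ k≤i)))
                   (β⁻β⁺≤ββ d (begin
                     i ∸ j          ≡⟨⟩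
                     suc i ∸ suc j  ≤⟨ ∸-monoʳ-≤ (suc i) k≤1+j ⟩
                     suc i ∸ k      ≡⟨ +-∸-assoc 1 k≤i ⟩
                     suc (i ∸ k)    ∎))

  Σbc≤Σaa-at-0 : ∀ r → Σbc 0 r ≤ Σaa 0 r
  Σbc≤Σaa-at-0 r = subst (_≤ Σaa 0 r) (sym (Σbc₀≡0 r)) z≤n

  Σbc≤Σaa-short : ∀ i r → r ≤ 1 → Σbc i r ≤ Σaa i r
  Σbc≤Σaa-short zero    r _   = Σbc≤Σaa-at-0 r
  Σbc≤Σaa-short (suc i) r r≤1 = conv-mono r (λ j _ → bc≤aa (suc i) j (r ∸ j) (r∸j≤1+ j i) (r∸j≤1+ j j))
    where
    r∸j≤1+ : ∀ j m → r ∸ j ≤ suc m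
    r∸j≤1+ j m = ≤-trans (m∸n≤m r j) (≤-trans r≤1 (s≤s z≤n))

  δaa≡diag : ∀ {i} r t → i ≡ suc r + t → δaa i r ≡ diag d (suc i) t
  δaa≡diag r t refl = outer-≡ (a i′) (a i′) r (a-≤ {i′} z≤n) a-outer a-outer (a-≤ {i′} z≤n)
    where
    i′ : ℕ
    i′ = suc (suc r + t)
    a-outer : a i′ (suc (suc r)) ≡ β d t
    a-outer = trans (a-≤ (s≤s (s≤s (m≤m+n r t)))) (cong (β d) (m+n∸m≡n (suc r) t))

  δbc≡cross : ∀ {i} r t → i ≡ suc r + t → δbc i r ≡ cross d (suc i) t
  δbc≡cross r t refl = outer-≡ (b i′) (c i′) r (b-≤ {i′} z≤n)
    (trans (c-≤ (s≤s (s≤s (m≤m+n r t)))) (cong (β⁺ d) (m+n∸m≡n (suc r) t)))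
    (trans (b-≤ (s≤s (s≤s (m≤m+n r t)))) (cong (β⁻ d) (m+n∸m≡n (suc r) t)))
    (c-≤ {i′} z≤n)
    where
    i′ : ℕ
    i′ = suc (suc r + t)

  δaa≡0 : ∀ i r → i < suc r → δaa i r ≡ 0
  δaa≡0 i r i<1+r = trans (outer-≡ (a (suc i)) (a (suc i)) r refl (a-> (s≤s i<1+r)) (a-> (s≤s i<1+r)) refl)
                          (trans (+-identityʳ _) (*-zeroʳ (a (suc i) 0)))

  δbc≡0 : ∀ i r → i < r → δbc i r ≡ 0
  δbc≡0 i r i<r =
    trans (outer-≡ (b (suc i)) (c (suc i)) r refl (c-> (s≤s (s≤s i<r))) (b-> (s≤s (m<n⇒m<1+n i<r))) refl)
          (trans (+-identityʳ _) (*-zeroʳ (b (suc i) 0)))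

  δbc<δaa-inward : ∀ i r → δbc (suc i) (suc (suc r)) < δaa (suc i) (suc (suc r)) → δbc i r < δaa i r
  δbc<δaa-inward i r outer< with suc (suc r) ≤? i
  ... | no r+2≰i = ⊥-elim (n≮0 (subst (δbc (suc i) (suc (suc r)) <_)
                                      (δaa≡0 (suc i) (suc (suc r)) (s≤s (≰⇒> r+2≰i))) outer<))
  ... | yes r+2≤i with m≤n⇒∃[o]m+o≡n r+2≤i
  ... | t , refl = subst₂ _<_ (sym (δbc≡cross r (suc t) i≡)) (sym (δaa≡diag r (suc t) i≡))
    (crossPoly<2denom⇒cross<diag d (3 + r + t) (suc t) (crossPoly<2denom-inward d t (3 + r)
      (cross<diag⇒crossPoly<2denom d (4 + r + t) t
        (subst₂ _<_ (δbc≡cross (2 + r) t refl) (δaa≡diag (2 + r) t refl) outer<))))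
    where
    i≡ : 2 + r + t ≡ suc r + suc t
    i≡ = cong suc (sym (+-suc r t))

  Σbc≤Σaa-start : ∀ {p r₀} → r₀ ≤ 1 ⊎ p ≡ 0 → Σbc p r₀ ≤ Σaa p r₀
  Σbc≤Σaa-start {p} {r₀} (inj₁ r₀≤1) = Σbc≤Σaa-short p r₀ r₀≤1
  Σbc≤Σaa-start {r₀ = r₀} (inj₂ refl) = Σbc≤Σaa-at-0 r₀

module Narrow {d} (d≤1 : d ≤ 1) where
  open Coefficients d

  b≤a : ∀ i j → b i j ≤ a i j
  b≤a i j with j ≤? i
  ... | yes j≤i = subst₂ _≤_ (sym (b-≤ j≤i)) (sym (a-≤ j≤i)) (β⁻≤β d (i ∸ j))
  ... | no  j≰i = subst (_≤ a i j) (sym (b-> (≰⇒> j≰i))) z≤n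

  c≤a : ∀ i j → c i j ≤ a i j
  c≤a i j with j ≤? i
  ... | yes j≤i = subst₂ _≤_ (sym (c-≤ j≤i)) (sym (a-≤ j≤i)) (β⁺≤β (i ∸ j) d≤1)
  ... | no  j≰i with m≤n⇒m<n∨m≡n (≰⇒> j≰i)
  ...   | inj₁ 1+i<j = subst (_≤ a i j) (sym (c-> 1+i<j)) z≤n
  ...   | inj₂ refl  = subst (_≤ a i (suc i)) (sym (trans (c-top i) (term₊-top-narrow d≤1))) z≤n

  Σbc≤Σaa : ∀ i r → Σbc i r ≤ Σaa i r
  Σbc≤Σaa i r = conv-mono r (λ j _ → *-mono-≤ (b≤a i j) (c≤a i (r ∸ j)))

-- (k, r) is reached from the starting point (p, r₀) by q steps (i, r) ↦ (i + 1, r + 2).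
data Peeling : ℕ → ℕ → Set where
  peel : ∀ p q r₀ → r₀ ≤ 1 ⊎ p ≡ 0 → Peeling (q + p) (double q + r₀)

peeling : ∀ k r → Peeling k r
peeling k       zero          = peel k 0 0 (inj₁ z≤n)
peeling k       (suc zero)    = peel k 0 1 (inj₁ ≤-refl)
peeling zero    (suc (suc r)) = peel 0 0 (suc (suc r)) (inj₂ refl)
peeling (suc k) (suc (suc r)) with peeling k r
... | peel p q r₀ start = peel p (suc q) r₀ start

module Wide (d′ : ℕ) where
  open Coefficients (suc (suc d′))

  Σaa-diagonal : ∀ N → Σaa N N ≡ conv (β (suc (suc d′))) (β (suc (suc d′))) N
  Σaa-diagonal N = conv-cong N (λ j j≤N → trans
    (cong₂ _*_ (a-≤ j≤N) (trans (a-≤ (m∸n≤m N j)) (cong (β _) (m∸[m∸n]≡n j≤N))))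
    (*-comm (β _ (N ∸ j)) (β _ j)))

  Σbc-diagonal : ∀ N → Σbc N N + β (4 + d′) N ≡ conv (β d′) (β (4 + d′)) N
  Σbc-diagonal zero    = cong (_+ 1) (Σbc₀≡0 0)
  Σbc-diagonal (suc M) = begin-equality
    Σbc (suc M) (suc M) + β (4 + d′) (suc M)
      ≡⟨ cong (_+ β (4 + d′) (suc M)) (conv-snoc (b (suc M)) (c (suc M)) M) ⟩
    conv (b (suc M)) (c (suc M) ∘ suc) M + b (suc M) (suc M) * c (suc M) 0 + β (4 + d′) (suc M)
      ≡⟨ cong₂ (λ x y → x + y * c (suc M) 0 + β (4 + d′) (suc M)) inner
               (trans (b-≤ (≤-refl {suc M})) (cong (β⁻ _) (n∸n≡0 M))) ⟩
    conv (β d′ ∘ suc) (β (4 + d′)) M + 0 + β (4 + d′) (suc M)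
      ≡⟨ rotate (conv (β d′ ∘ suc) (β (4 + d′)) M) (β (4 + d′) (suc M)) ⟩
    conv (β d′) (β (4 + d′)) (suc M) ∎
    where
    rotate : ∀ x y → x + 0 + y ≡ 1 * y + x
    rotate = solve-∀
    inner : conv (b (suc M)) (c (suc M) ∘ suc) M ≡ conv (β d′ ∘ suc) (β (4 + d′)) M
    inner = conv-cong M (λ j j≤M → trans (cong₂ _*_
      (trans (b-≤ (m≤n⇒m≤1+n j≤M)) (trans (cong (β⁻ _) (+-∸-assoc 1 j≤M)) (β⁻-suc _ (M ∸ j))))
      (trans (c-≤ (s≤s (m∸n≤m M j))) (trans (cong (β⁺ _) (m∸[m∸n]≡n j≤M)) (β⁺≡β-suc d′ j))))
      (*-comm (β (4 + d′) (M ∸ j)) (β d′ (suc j))))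

  δbc-diagonal : ∀ N → δbc N N ≡ β (4 + d′) N
  δbc-diagonal N = begin-equality
    δbc N N
      ≡⟨ outer-≡ (b (suc N)) (c (suc N)) N (b-≤ {suc N} z≤n) (c-top (suc N)) (b-> (n<1+n (suc N))) refl ⟩
    β⁻ _ (suc N) * 1 + 0 * c (suc N) 0
      ≡⟨ trans (+-identityʳ _) (*-identityʳ _) ⟩
    β⁻ _ (suc N)
      ≡⟨ β⁻-suc _ N ⟩
    β (4 + d′) N ∎

  -- At r = i + 1 nothing is truncated and both sides are full convolutions, equal by conv-β-shift.
  Σbc≡Σaa-top : ∀ N → Σbc (suc N) (suc (suc N)) ≡ Σaa (suc N) (suc (suc N))
  Σbc≡Σaa-top N = begin-equality
    Σbc (suc N) (suc (suc N))                        ≡⟨ Σbc-peel N N ⟩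
    Σbc N N + δbc N N                                 ≡⟨ cong (_+_ (Σbc N N)) (δbc-diagonal N) ⟩
    Σbc N N + β (4 + d′) N                           ≡⟨ Σbc-diagonal N ⟩
    conv (β d′) (β (4 + d′)) N                     ≡⟨ conv-β-shift N d′ (3 + d′) ⟩
    conv (β (1 + d′)) (β (3 + d′)) N               ≡⟨ conv-β-shift N (1 + d′) (2 + d′) ⟩
    conv (β (2 + d′)) (β (2 + d′)) N               ≡⟨ Σaa-diagonal N ⟨
    Σaa N N                                          ≡⟨ +-identityʳ (Σaa N N) ⟨
    Σaa N N + 0                                      ≡⟨ cong (_+_ (Σaa N N)) (δaa≡0 N N (n<1+n N)) ⟨
    Σaa N N + δaa N N                                 ≡⟨ Σaa-peel N N ⟨
    Σaa (suc N) (suc (suc N))                        ∎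

  Σbc≤Σaa-above : ∀ i r → i < r → Σbc i r ≤ Σaa i r
  Σbc≤Σaa-above zero    r             _                 = Σbc≤Σaa-at-0 r
  Σbc≤Σaa-above (suc i) (suc (suc r)) (s≤s (s≤s i≤r)) with m≤n⇒m<n∨m≡n i≤r
  ... | inj₂ refl = ≤-reflexive (Σbc≡Σaa-top i)
  ... | inj₁ i<r  = begin
    Σbc (suc i) (suc (suc r))   ≡⟨ Σbc-peel i r ⟩
    Σbc i r + δbc i r            ≡⟨ cong (_+_ (Σbc i r)) (δbc≡0 i r i<r) ⟩
    Σbc i r + 0                 ≤⟨ +-mono-≤ (Σbc≤Σaa-above i r i<r) z≤n ⟩
    Σaa i r + δaa i r            ≡⟨ Σaa-peel i r ⟨
    Σaa (suc i) (suc (suc r))   ∎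

  Σbc≤Σaa : ∀ k r → Σbc k r ≤ Σaa k r
  Σbc≤Σaa k r with peeling k r
  ... | peel p q r₀ start = R≤L-downwards (suc p) q (Σbc≤Σaa-above _ _ top<)
    where
    open SingleCrossing (λ ℓ → Σbc (ℓ + p) (double ℓ + r₀)) (λ ℓ → Σaa (ℓ + p) (double ℓ + r₀))
                        (λ ℓ → δbc (ℓ + p) (double ℓ + r₀)) (λ ℓ → δaa (ℓ + p) (double ℓ + r₀))
                        (λ ℓ → Σbc-peel (ℓ + p) (double ℓ + r₀)) (λ ℓ → Σaa-peel (ℓ + p) (double ℓ + r₀))
                        (λ ℓ → δbc<δaa-inward (ℓ + p) (double ℓ + r₀)) (Σbc≤Σaa-start start)
    top< : suc p + q + p < double (suc p + q) + r₀
    top< = begin-strict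
      suc p + q + p              <⟨ +-monoʳ-< (suc p + q) (m≤m+n (suc p) q) ⟩
      suc p + q + (suc p + q)    ≡⟨ double≡n+n (suc p + q) ⟨
      double (suc p + q)         ≤⟨ m≤m+n _ r₀ ⟩
      double (suc p + q) + r₀    ∎

Σbc≤Σaa : ∀ d i r → Coefficients.Σbc d i r ≤ Coefficients.Σaa d i r
Σbc≤Σaa zero             = Narrow.Σbc≤Σaa z≤n
Σbc≤Σaa (suc zero)       = Narrow.Σbc≤Σaa (s≤s z≤n)
Σbc≤Σaa (suc (suc d′))   = Wide.Σbc≤Σaa d′

m≤n/2⇒double-m≤n : ∀ {m n} → m ≤ n / 2 → double m ≤ n
m≤n/2⇒double-m≤n {m} {n} m≤n/2 = begin
  double m         ≡⟨ double≡n+n m ⟩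
  m + m            ≤⟨ +-mono-≤ m≤n/2 m≤n/2 ⟩
  n / 2 + n / 2    ≡⟨ cong (_+_ (n / 2)) (+-identityʳ (n / 2)) ⟨
  2 * (n / 2)      ≡⟨ *-comm 2 (n / 2) ⟩
  n / 2 * 2        ≤⟨ m/n*n≤m n 2 ⟩
  n                ∎

theorem4p3 : (n i : ℕ) → i ≤ n / 2 → (r : ℕ) →
    sumPairs (Data.Nat._+_ i 1) r
      (λ j k → binom (+ n -ℤ + 2 *ℤ + j) (+ i -ℤ + 1 -ℤ + j)
               * binom (+ n -ℤ + 2 *ℤ + k) (+ i +ℤ + 1 -ℤ + k))
    ≤ sumPairs i r
      (λ j k → binom (+ n -ℤ + 2 *ℤ + j) (+ i -ℤ + j)
               * binom (+ n -ℤ + 2 *ℤ + k) (+ i -ℤ + k))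
theorem4p3 n i i≤n/2 r with m≤n⇒∃[o]m+o≡n (m≤n/2⇒double-m≤n {n = n} i≤n/2)
... | d , refl = begin
  _       ≡⟨ sumPairs≡conv (i + 1) r (b i) (c i) (λ j i+1<j → b-> (≤-trans (s≤s (m≤m+n i 1)) i+1<j))
                                                 (λ j i+1<j → c-> (subst (_< j) (+-comm i 1) i+1<j)) ⟩
  Σbc i r   ≤⟨ Σbc≤Σaa d i r ⟩
  Σaa i r   ≡⟨ sumPairs≡conv i r (a i) (a i) (λ _ → a->) (λ _ → a->) ⟨
  _       ∎
  where open Coefficients d
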